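{- Let $\Sigma$ be a finite alphabet, let $0,A$ be two letters not in $\Sigma$, let $\Gamma=\{0,A\}$, and let $h:\Sigma^\omega\to(\Sigma\cup\{0,A\})^\omega$ and $\alpha\in\Gamma^\omega$ be defined by $h(x)=0.A.x(1).0^2.x(2).0^3.A.x(3).0^4.x(4)\cdots 0^{2n}.x(2n).0^{2n+1}.A.x(2n+1)\cdots$, $\alpha=0.AA.0^2.A.0^3.AA.0^4.A.0^5\cdots AA.0^{2n}.A.0^{2n+1}.AA.0^{2n+2}\cdots$. Then the set $R_2=(\Sigma\cup\{0,A\})^\omega\times\Gamma^\omega\setminus(h(\Sigma^\omega)\times\{\alpha\})$ is an infinitary rational relation.
   Context: An infinitary rational relation is a set of pairs $(u,v)\in\Sigma_1^\omega\times\Gamma^\omega$ accepted by a 2-tape Büchi automaton $(K,\Sigma_1,\Gamma,\Delta,q_0,F)$, with $K$ finite, $\Delta\subseteq K\times\Sigma_1^\star\times\Gamma^\star\times K$ finite, $F\subseteq K$, where $(u,v)$ is accepted if there is an infinite sequence of transitions $(q_0,u_1,v_1,q_1),(q_1,u_2,v_2,q_2),\dots$ visiting some state of $F$ infinitely often with $u=u_1u_2\cdots$, $v=v_1v_2\cdots$. -}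

module Defs where

open import Data.Nat using (ℕ; zero; suc; _≤_)
open import Data.Fin using (Fin; toℕ)
open import Data.Bool using (Bool; true; false; if_then_else_)
open import Data.List using (List; []; _∷_; _++_; length; lookup; replicate)
open import Data.List.Membership.Propositional using (_∈_)
open import Data.Product using (Σ; ∃; _×_; _,_)
open import Relation.Binary.PropositionalEquality using (_≡_)
open import Relation.Nullary using (¬_)

-- Infinite words over X are functions ℕ → X (position 0 is the first letter).
ω-Word : Set → Set
ω-Word X = ℕ → X

Prefix : {X : Set} → List X → ω-Word X → Set
Prefix w u = (i : Fin (length w)) → lookup w i ≡ u (toℕ i)

catUpTo : {X : Set} → (ℕ → List X) → ℕ → List X
catUpTo f zero    = []
catUpTo f (suc k) = catUpTo f k ++ f k

-- u = f 0 · f 1 · f 2 ⋯  (the infinite concatenation of the finite words f i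
-- is the infinite word u): every finite partial concatenation is a prefix of u,
-- and the partial concatenations have unbounded length.
IsConcat : {X : Set} → (ℕ → List X) → ω-Word X → Set
IsConcat f u = ((k : ℕ) → Prefix (catUpTo f k) u)
             × ((n : ℕ) → ∃ λ k → n ≤ length (catUpTo f k))

record Transition (n : ℕ) (X Y : Set) : Set where
  constructor trans
  field
    src : Fin n
    inp : List X
    out : List Y
    tgt : Fin n

record Automaton (X Y : Set) : Set where
  field
    nstates : ℕ
    Δ       : List (Transition nstates X Y)
    q₀      : Fin nstates
    F       : Fin nstates → Bool

Accepts : {X Y : Set} → Automaton X Y → ω-Word X → ω-Word Y → Set
Accepts {X} {Y} M u v =
  Σ (ℕ → Transition nstates X Y) λ ρ →
      ((i : ℕ) → ρ i ∈ Δ)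
    × (Transition.src (ρ 0) ≡ q₀)
    × ((i : ℕ) → Transition.tgt (ρ i) ≡ Transition.src (ρ (suc i)))
    × ((n : ℕ) → ∃ λ m → n ≤ m × F (Transition.tgt (ρ m)) ≡ true)
    × IsConcat (λ i → Transition.inp (ρ i)) u
    × IsConcat (λ i → Transition.out (ρ i)) v
  where open Automaton M

InfinitaryRational : {X Y : Set} → (ω-Word X → ω-Word Y → Set) → Set
InfinitaryRational {X} {Y} R =
  Σ (Automaton X Y) λ M → (u : ω-Word X) (v : ω-Word Y) →
    (R u v → Accepts M u v) × (Accepts M u v → R u v)

data Letter (s : ℕ) : Set where
  O : Letter s
  A : Letter s
  sym : Fin s → Letter s

data Γ : Set where
  gO : Γ
  gA : Γ

isOdd : ℕ → Bool
isOdd zero    = false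
isOdd (suc n) = if isOdd n then false else true

-- Block number n ≥ 1 of h(x) is 0^n (A if n odd) x(n).
-- Block index k (from 0) corresponds to n = k+1; x(n) is x k (0-indexed words).
hBlock : {s : ℕ} → ω-Word (Fin s) → ℕ → List (Letter s)
hBlock x k = replicate (suc k) O ++ (if isOdd (suc k) then A ∷ [] else []) ++ sym (x k) ∷ []

αBlock : ℕ → List Γ
αBlock k = replicate (suc k) gO ++ (if isOdd (suc k) then gA ∷ gA ∷ [] else gA ∷ [])

IsH : {s : ℕ} → ω-Word (Fin s) → ω-Word (Letter s) → Set
IsH x u = IsConcat (hBlock x) u

Isα : ω-Word Γ → Set
Isα v = IsConcat αBlock v

R₂ : (s : ℕ) → ω-Word (Letter s) → ω-Word Γ → Set
R₂ s u v = ¬ ((∃ λ (x : ω-Word (Fin s)) → IsH x u) × Isα v)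

-- The automaton guesses a local defect of (u, v) and then accepts everything in a final sink state.  Apart from
-- the defect transitions it follows (h(x), α) in two ways.  In phase a it reads the k-th blocks of both tapes in
-- parallel, checking that they have equally many zeros and matching ends (A σ against AA, or σ against A).  In
-- phase b it reads the (k+1)-st block of u against the k-th block of v, checking that u has one zero more and that
-- the ends alternate.  Runs without defects never reach the sink, so (h(x), α) is rejected.  Conversely, if (u, v)
-- is rejected then no defect can fire, and the two phases force block by block that v = α and u = h(x), where
-- x(k) is the symbol ending the k-th block of u.  This direction, rejected ⇒ (u, v) ∈ h(Σ^ω) × {α}, is
-- constructive; excluded middle turns it into (u, v) ∈ R₂ ⇒ accepted.
module Submission where

open import Axiom.ExcludedMiddle using (ExcludedMiddle)
open import Data.Bool using (Bool; true; false; if_then_else_; not; _∧_; T)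
open import Data.Empty using (⊥; ⊥-elim)
open import Data.Fin using (Fin; #_) renaming (zero to fzero; suc to fsuc)
open import Data.List using (List; []; _∷_; _++_; length; replicate; map; concat; filter; cartesianProduct; allFin; lookup)
open import Data.List.Membership.Propositional using (_∈_)
open import Data.List.Membership.Propositional.Properties
  using (∈-map⁺; ∈-map⁻; ∈-filter⁺; ∈-filter⁻; ∈-allFin; ∈-concat⁺′; ∈-lookup; ∈-cartesianProduct⁺; ∈-++⁺ˡ; ∈-++⁺ʳ)
open import Data.List.Properties using (length-++; length-replicate; ++-assoc; ++-identityʳ)
open import Data.List.Relation.Unary.Any using (here; there)
open import Data.Nat using (ℕ; zero; suc; _+_; _≤_; z≤n; s≤s)
open import Data.Nat.Properties
  using (+-suc; +-assoc; +-comm; +-identityʳ; +-mono-≤; ≤-refl; ≤-reflexive; ≤-trans; n≤1+n; m≤n+m)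
open import Data.Product using (Σ; ∃; ∃₂; _×_; _,_; proj₁; proj₂; uncurry)
open import Data.Unit using (tt)
open import Function using (_∘_)
open import Level using (0ℓ)
open import Relation.Binary.PropositionalEquality
  using (_≡_; refl; cong; cong₂; subst; module ≡-Reasoning) renaming (sym to ≡-sym; trans to ≡-trans)
open import Relation.Nullary using (¬_)
open import Relation.Nullary.Decidable using (T?; decidable-stable)

open import Defs

dropω : {X : Set} → ℕ → ω-Word X → ω-Word X
dropω n u i = u (n + i)

_≐_ : {X : Set} → ω-Word X → ω-Word X → Set
u ≐ u′ = ∀ i → u i ≡ u′ i

dropω-+ : {X : Set} (m n : ℕ) (u : ω-Word X) → dropω (m + n) u ≐ dropω n (dropω m u)
dropω-+ m n u i = cong u (+-assoc m n i)

dropω-cong : {X : Set} {m n : ℕ} (u : ω-Word X) → m ≡ n → dropω m u ≐ dropω n u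
dropω-cong u refl i = refl

dropω-++ : {X Z : Set} (w w′ : List Z) (u : ω-Word X) → dropω (length (w ++ w′)) u ≐ dropω (length w′) (dropω (length w) u)
dropω-++ w w′ u i = ≡-trans (dropω-cong u (length-++ w) i) (dropω-+ (length w) (length w′) u i)

dropω-replicate-++ : {X Z : Set} (k : ℕ) {a : Z} (w : List Z) (u : ω-Word X) →
                     dropω (length (replicate k a ++ w)) u ≐ dropω (length w) (dropω k u)
dropω-replicate-++ k w u i = ≡-trans (dropω-++ (replicate k _) w u i) (cong (λ n → u (n + (length w + i))) (length-replicate k))

replicate-++-∷ : {Z : Set} (k : ℕ) (a : Z) (w : List Z) → replicate k a ++ a ∷ w ≡ a ∷ replicate k a ++ w
replicate-++-∷ zero    a w = refl
replicate-++-∷ (suc k) a w = cong (a ∷_) (replicate-++-∷ k a w)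

-- A record rather than Prefix itself, so that w and u can be inferred from a proof.
record _≼_ {X : Set} (w : List X) (u : ω-Word X) : Set where
  constructor mk≼
  field prefix : Prefix w u
open _≼_

module _ {X : Set} where

  ≼-[] : {u : ω-Word X} → [] ≼ u
  ≼-[] = mk≼ λ ()

  ≼-∷ : {a : X} {w : List X} {u : ω-Word X} → u 0 ≡ a → w ≼ dropω 1 u → (a ∷ w) ≼ u
  ≼-∷ {a} {w} {u} u₀≡a (mk≼ p) = mk≼ q
    where
    q : Prefix (a ∷ w) u
    q fzero    = ≡-sym u₀≡a
    q (fsuc i) = p i

  ≼-head : {a : X} {w : List X} {u : ω-Word X} → (a ∷ w) ≼ u → u 0 ≡ a
  ≼-head (mk≼ p) = ≡-sym (p fzero)

  ≼-tail : {a : X} {w : List X} {u : ω-Word X} → (a ∷ w) ≼ u → w ≼ dropω 1 u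
  ≼-tail (mk≼ p) = mk≼ λ i → p (fsuc i)

  ≼-second : {a b : X} {w : List X} {u : ω-Word X} → (a ∷ b ∷ w) ≼ u → u 1 ≡ b
  ≼-second p = ≼-head (≼-tail p)

  ≼-third : {a b c : X} {w : List X} {u : ω-Word X} → (a ∷ b ∷ c ∷ w) ≼ u → u 2 ≡ c
  ≼-third p = ≼-head (≼-tail (≼-tail p))

  ≼¹ : {a : X} {u : ω-Word X} → u 0 ≡ a → (a ∷ []) ≼ u
  ≼¹ e = ≼-∷ e ≼-[]

  ≼² : {a b : X} {u : ω-Word X} → u 0 ≡ a → u 1 ≡ b → (a ∷ b ∷ []) ≼ u
  ≼² e e′ = ≼-∷ e (≼¹ e′)

  ≼³ : {a b c : X} {u : ω-Word X} → u 0 ≡ a → u 1 ≡ b → u 2 ≡ c → (a ∷ b ∷ c ∷ []) ≼ u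
  ≼³ e e′ e″ = ≼-∷ e (≼² e′ e″)

  ≼-resp : {w : List X} {u u′ : ω-Word X} → u ≐ u′ → w ≼ u → w ≼ u′
  ≼-resp u≐u′ (mk≼ p) = mk≼ λ i → ≡-trans (p i) (u≐u′ _)

  ≼-++⁻ˡ : (w : List X) {w′ : List X} {u : ω-Word X} → (w ++ w′) ≼ u → w ≼ u
  ≼-++⁻ˡ []      p = ≼-[]
  ≼-++⁻ˡ (a ∷ w) p = ≼-∷ (≼-head p) (≼-++⁻ˡ w (≼-tail p))

  ≼-++⁻ʳ : (w : List X) {w′ : List X} {u : ω-Word X} → (w ++ w′) ≼ u → w′ ≼ dropω (length w) u
  ≼-++⁻ʳ []      (mk≼ p) = mk≼ p
  ≼-++⁻ʳ (a ∷ w) p       = ≼-++⁻ʳ w (≼-tail p)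

  ≼-++⁺ : (w : List X) {w′ : List X} {u : ω-Word X} → w ≼ u → w′ ≼ dropω (length w) u → (w ++ w′) ≼ u
  ≼-++⁺ []      p (mk≼ q) = mk≼ q
  ≼-++⁺ (a ∷ w) p q       = ≼-∷ (≼-head p) (≼-++⁺ w (≼-tail p) q)

  agree : {c a b : X} → c ≡ a → c ≡ b → a ≡ b
  agree c≡a c≡b = ≡-trans (≡-sym c≡a) c≡b

  conflict : {c a b : X} → c ≡ a → c ≡ b → ¬ a ≡ b → ⊥
  conflict c≡a c≡b a≢b = a≢b (agree c≡a c≡b)

  ∈-concat-lookup : {x : X} (xss : List (List X)) (i : Fin (length xss)) → x ∈ lookup xss i → x ∈ concat xss
  ∈-concat-lookup xss i x∈ = ∈-concat⁺′ x∈ (∈-lookup {xs = xss} i)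

  ≼-replicate-++⁻ʳ : (j : ℕ) {a : X} {w : List X} {u : ω-Word X} → (replicate j a ++ w) ≼ u → w ≼ dropω j u
  ≼-replicate-++⁻ʳ zero    (mk≼ p) = mk≼ p
  ≼-replicate-++⁻ʳ (suc j) p       = ≼-replicate-++⁻ʳ j (≼-tail p)

  ≼-replicate-++⁺ : (j : ℕ) {a : X} {w : List X} {u : ω-Word X} →
                    replicate j a ≼ u → w ≼ dropω j u → (replicate j a ++ w) ≼ u
  ≼-replicate-++⁺ zero    p (mk≼ q) = mk≼ q
  ≼-replicate-++⁺ (suc j) p q       = ≼-∷ (≼-head p) (≼-replicate-++⁺ j (≼-tail p) q)

  concatFrom : (ℕ → List X) → ℕ → ℕ → List X
  concatFrom g k zero    = []
  concatFrom g k (suc n) = g k ++ concatFrom g (suc k) n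

  concatFrom-snoc : (g : ℕ → List X) (k n : ℕ) → concatFrom g k (suc n) ≡ concatFrom g k n ++ g (k + n)
  concatFrom-snoc g k zero    = ≡-trans (++-identityʳ (g k)) (cong g (≡-sym (+-identityʳ k)))
  concatFrom-snoc g k (suc n) = begin
    g k ++ concatFrom g (suc k) (suc n)            ≡⟨ cong (g k ++_) (concatFrom-snoc g (suc k) n) ⟩
    g k ++ (concatFrom g (suc k) n ++ g (suc k + n)) ≡⟨ ++-assoc (g k) _ _ ⟨
    concatFrom g k (suc n) ++ g (suc (k + n))       ≡⟨ cong (λ m → concatFrom g k (suc n) ++ g m) (+-suc k n) ⟨
    concatFrom g k (suc n) ++ g (k + suc n)         ∎
    where open ≡-Reasoning

  catUpTo≡concatFrom : (g : ℕ → List X) (n : ℕ) → catUpTo g n ≡ concatFrom g 0 n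
  catUpTo≡concatFrom g zero    = refl
  catUpTo≡concatFrom g (suc n) = ≡-trans (cong (_++ g n) (catUpTo≡concatFrom g n)) (≡-sym (concatFrom-snoc g 0 n))

  Spells : (ℕ → List X) → ℕ → ω-Word X → Set
  Spells g k u = ∀ n → concatFrom g k n ≼ u

  Spells-head : {g : ℕ → List X} {k : ℕ} {u : ω-Word X} → Spells g k u → g k ≼ u
  Spells-head {g} {k} sp = ≼-++⁻ˡ (g k) (sp 1)

  Spells-tail : {g : ℕ → List X} {k : ℕ} {u : ω-Word X} → Spells g k u → Spells g (suc k) (dropω (length (g k)) u)
  Spells-tail {g} {k} sp n = ≼-++⁻ʳ (g k) (sp (suc n))

  Spells⁺ : List X → (ℕ → List X) → ℕ → ω-Word X → Set
  Spells⁺ w g k u = w ≼ u × Spells g k (dropω (length w) u)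

  Spells⇒Spells⁺ : {g : ℕ → List X} {k : ℕ} {u : ω-Word X} → Spells g k u → Spells⁺ (g k) g (suc k) u
  Spells⇒Spells⁺ sp = Spells-head sp , Spells-tail sp

  Spells⁺-≡ : {w w′ : List X} {g : ℕ → List X} {k : ℕ} {u : ω-Word X} →
              w ≡ w′ → Spells⁺ w g k u → Spells⁺ w′ g k u
  Spells⁺-≡ refl sp = sp

  Spells⁺-tail : {a : X} {w : List X} {g : ℕ → List X} {k : ℕ} {u : ω-Word X} →
                 Spells⁺ (a ∷ w) g k u → Spells⁺ w g k (dropω 1 u)
  Spells⁺-tail (p , sp) = ≼-tail p , sp

  catUpTo-suc : (g : ℕ → List X) (n : ℕ) → catUpTo g (suc n) ≡ g 0 ++ catUpTo (λ i → g (suc i)) n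
  catUpTo-suc g zero    = ≡-sym (++-identityʳ (g 0))
  catUpTo-suc g (suc n) = ≡-trans (cong (_++ g (suc n)) (catUpTo-suc g n)) (++-assoc (g 0) _ (g (suc n)))

  IsConcat-intro : {f : ℕ → List X} {u : ω-Word X} →
                   (∀ k → 1 ≤ length (f k)) → (∀ K → catUpTo f K ≼ u) → IsConcat f u
  IsConcat-intro {f} nonempty prefixes = (λ K → prefix (prefixes K)) , λ n → n , n≤length n
    where
    n≤length : ∀ n → n ≤ length (catUpTo f n)
    n≤length zero    = z≤n
    n≤length (suc n) = subst (suc n ≤_) (≡-sym (length-++ (catUpTo f n)))
                         (subst (_≤ length (catUpTo f n) + length (f n)) (+-comm n 1) (+-mono-≤ (n≤length n) (nonempty n)))

  IsConcat⇒Spells : {f : ℕ → List X} {u : ω-Word X} → IsConcat f u → Spells f 0 u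
  IsConcat⇒Spells {f} {u} (prefixes , _) n = subst (_≼ u) (catUpTo≡concatFrom f n) (mk≼ (prefixes n))

  IsConcat-resp : {f : ℕ → List X} {u u′ : ω-Word X} → u ≐ u′ → IsConcat f u → IsConcat f u′
  IsConcat-resp {f} u≐u′ (prefixes , unbounded) =
    (λ n → prefix (≼-resp u≐u′ (mk≼ {w = catUpTo f n} (prefixes n)))) , unbounded

  IsConcat-∷ : (g : ℕ → List X) {u : ω-Word X} →
               g 0 ≼ u → IsConcat (λ i → g (suc i)) (dropω (length (g 0)) u) → IsConcat g u
  IsConcat-∷ g {u} p (prefixes , unbounded) = prefixes′ , unbounded′
    where
    prefixes′ : ∀ n → Prefix (catUpTo g n) u
    prefixes′ zero    = λ ()
    prefixes′ (suc n) = prefix (subst (_≼ u) (≡-sym (catUpTo-suc g n)) (≼-++⁺ (g 0) p (mk≼ (prefixes n))))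
    unbounded′ : ∀ n → ∃ λ k → n ≤ length (catUpTo g k)
    unbounded′ n with unbounded n
    ... | k , n≤ = suc k , ≤-trans n≤ (≤-trans (m≤n+m _ (length (g 0)))
                     (≤-reflexive (≡-sym (≡-trans (cong length (catUpTo-suc g k)) (length-++ (g 0))))))

  IsConcat-letters : (u : ω-Word X) → IsConcat (λ i → u i ∷ []) u
  IsConcat-letters u = IsConcat-intro (λ _ → s≤s z≤n) (letters u)
    where
    letters : (u : ω-Word X) (n : ℕ) → catUpTo (λ i → u i ∷ []) n ≼ u
    letters u zero    = ≼-[]
    letters u (suc n) = subst (_≼ u) (≡-sym (catUpTo-suc (λ i → u i ∷ []) n)) (≼-∷ refl (letters (dropω 1 u) n))

length-catUpTo-cong : {X Y : Set} (f : ℕ → List X) (g : ℕ → List Y) →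
                      (∀ k → length (f k) ≡ length (g k)) → ∀ K → length (catUpTo f K) ≡ length (catUpTo g K)
length-catUpTo-cong f g eq zero    = refl
length-catUpTo-cong f g eq (suc K) = begin
  length (catUpTo f K ++ f K)             ≡⟨ length-++ (catUpTo f K) ⟩
  length (catUpTo f K) + length (f K)     ≡⟨ cong₂ _+_ (length-catUpTo-cong f g eq K) (eq K) ⟩
  length (catUpTo g K) + length (g K)     ≡⟨ length-++ (catUpTo g K) ⟨
  length (catUpTo g K ++ g K)             ∎
  where open ≡-Reasoning

-- Runs of 2-tape Büchi automata

module _ {X Y : Set} (M : Automaton X Y) where
  open Automaton M
  open Transition

  -- A record, unlike Accepts, so that q, u and v can be inferred from a proof.
  record AcceptsFrom (q : Fin nstates) (u : ω-Word X) (v : ω-Word Y) : Set where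
    constructor accepting
    field
      ρ       : ℕ → Transition nstates X Y
      ρ∈Δ     : (i : ℕ) → ρ i ∈ Δ
      start   : src (ρ 0) ≡ q
      chain   : (i : ℕ) → tgt (ρ i) ≡ src (ρ (suc i))
      büchi   : (n : ℕ) → ∃ λ m → n ≤ m × F (tgt (ρ m)) ≡ true
      inputs  : IsConcat (λ i → inp (ρ i)) u
      outputs : IsConcat (λ i → out (ρ i)) v

  Accepts⇒AcceptsFrom : {u : ω-Word X} {v : ω-Word Y} → Accepts M u v → AcceptsFrom q₀ u v
  Accepts⇒AcceptsFrom (ρ , ρ∈Δ , start , chain , büchi , inputs , outputs) =
    accepting ρ ρ∈Δ start chain büchi inputs outputs

  AcceptsFrom⇒Accepts : {u : ω-Word X} {v : ω-Word Y} → AcceptsFrom q₀ u v → Accepts M u v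
  AcceptsFrom⇒Accepts (accepting ρ ρ∈Δ start chain büchi inputs outputs) =
    ρ , ρ∈Δ , start , chain , büchi , inputs , outputs

  AcceptsFrom-resp : {q : Fin nstates} {u u′ : ω-Word X} {v v′ : ω-Word Y} →
                     u ≐ u′ → v ≐ v′ → AcceptsFrom q u v → AcceptsFrom q u′ v′
  AcceptsFrom-resp u≐u′ v≐v′ (accepting ρ ρ∈Δ start chain büchi inputs outputs) =
    accepting ρ ρ∈Δ start chain büchi (IsConcat-resp u≐u′ inputs) (IsConcat-resp v≐v′ outputs)

  AcceptsFrom-∷ : {t : Transition nstates X Y} {u : ω-Word X} {v : ω-Word Y} → t ∈ Δ →
                  inp t ≼ u → out t ≼ v → AcceptsFrom (tgt t) (dropω (length (inp t)) u) (dropω (length (out t)) v) →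
                  AcceptsFrom (src t) u v
  AcceptsFrom-∷ {t} t∈Δ inp≼u out≼v (accepting ρ ρ∈Δ start chain büchi inputs outputs) =
    accepting ρ′ ρ′∈Δ refl chain′ büchi′
              (IsConcat-∷ (λ i → inp (ρ′ i)) inp≼u inputs) (IsConcat-∷ (λ i → out (ρ′ i)) out≼v outputs)
    where
    ρ′ : ℕ → Transition nstates X Y
    ρ′ zero    = t
    ρ′ (suc i) = ρ i
    ρ′∈Δ : (i : ℕ) → ρ′ i ∈ Δ
    ρ′∈Δ zero    = t∈Δ
    ρ′∈Δ (suc i) = ρ∈Δ i
    chain′ : (i : ℕ) → tgt (ρ′ i) ≡ src (ρ′ (suc i))
    chain′ zero    = ≡-sym start
    chain′ (suc i) = chain i
    büchi′ : (n : ℕ) → ∃ λ m → n ≤ m × F (tgt (ρ′ m)) ≡ true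
    büchi′ n with büchi n
    ... | m , n≤m , final = suc m , ≤-trans n≤m (n≤1+n m) , final

  AcceptsFrom-loop : {q : Fin nstates} → F q ≡ true → (∀ a b → trans q (a ∷ []) (b ∷ []) q ∈ Δ) →
                     (u : ω-Word X) (v : ω-Word Y) → AcceptsFrom q u v
  AcceptsFrom-loop {q} final loop∈Δ u v =
    accepting (λ i → trans q (u i ∷ []) (v i ∷ []) q) (λ i → loop∈Δ (u i) (v i)) refl (λ i → refl)
              (λ n → n , ≤-refl , final) (IsConcat-letters u) (IsConcat-letters v)

  AcceptsFrom-blocks : {q : Fin nstates} (f : ℕ → List X) (g : ℕ → List Y) →
    (∀ k {u v} → f k ≼ u → g k ≼ v →
       AcceptsFrom q (dropω (length (f k)) u) (dropω (length (g k)) v) → AcceptsFrom q u v) →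
    ∀ K {u v} → catUpTo f K ≼ u → catUpTo g K ≼ v →
    AcceptsFrom q (dropω (length (catUpTo f K)) u) (dropω (length (catUpTo g K)) v) → AcceptsFrom q u v
  AcceptsFrom-blocks f g block zero    pu pv acc = acc
  AcceptsFrom-blocks f g block (suc K) {u} {v} pu pv acc =
    AcceptsFrom-blocks f g block K (≼-++⁻ˡ (catUpTo f K) pu) (≼-++⁻ˡ (catUpTo g K) pv)
      (block K (≼-++⁻ʳ (catUpTo f K) pu) (≼-++⁻ʳ (catUpTo g K) pv)
        (AcceptsFrom-resp (dropω-++ (catUpTo f K) (f K) u) (dropω-++ (catUpTo g K) (g K) v) acc))

  module _ (Inv : Fin nstates → ω-Word X → ω-Word Y → Set)
           (preserved : ∀ {t u v} → t ∈ Δ → Inv (src t) u v → inp t ≼ u → out t ≼ v →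
                        Inv (tgt t) (dropω (length (inp t)) u) (dropω (length (out t)) v))
           (nonfinal : ∀ {q u v} → F q ≡ true → ¬ Inv q u v) where

    invariant⇒¬AcceptsFrom : {q : Fin nstates} {u : ω-Word X} {v : ω-Word Y} → Inv q u v → ¬ AcceptsFrom q u v
    invariant⇒¬AcceptsFrom {u = u} {v} inv (accepting ρ ρ∈Δ start chain büchi inputs outputs) =
      let m , _ , final          = büchi 0
          u′ , v′ , inv′ , su , sv = reach m
      in  nonfinal final (preserved (ρ∈Δ m) inv′ (Spells-head su) (Spells-head sv))
      where
      Reached : ℕ → Set
      Reached n = ∃₂ λ u′ v′ →
        Inv (src (ρ n)) u′ v′ × Spells (λ i → inp (ρ i)) n u′ × Spells (λ i → out (ρ i)) n v′

      reach : ∀ n → Reached n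
      reach zero    = u , v , subst (λ q → Inv q u v) (≡-sym start) inv , IsConcat⇒Spells inputs , IsConcat⇒Spells outputs
      reach (suc n) =
        let u′ , v′ , inv′ , su , sv = reach n
            u″ = dropω (length (inp (ρ n))) u′
            v″ = dropω (length (out (ρ n))) v′
        in  u″ , v″ , subst (λ q → Inv q u″ v″) (chain n) (preserved (ρ∈Δ n) inv′ (Spells-head su) (Spells-head sv)) ,
            Spells-tail su , Spells-tail sv

-- The automaton for R₂

module _ (s : ℕ) where

  private
    L : Set
    L = Letter s

  pattern qI  = fzero
  pattern qa₀ = fsuc fzero
  pattern qa  = fsuc (fsuc fzero)
  pattern qb₀ = fsuc (fsuc (fsuc fzero))
  pattern qb  = fsuc (fsuc (fsuc (fsuc fzero)))
  pattern qF  = fsuc (fsuc (fsuc (fsuc (fsuc fzero))))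

  data Scan : Set where
    enterA aFirstZero aZero bFirstZero bZero : Scan
    enterB aOddEnd aEvenEnd bOddEnd bEvenEnd : Fin s → Scan

  data Defect : Set where
    errI₁ errI₂ errI₃ errA₁ errA₄ errB₁ errB₂ errB₅ : L → Defect
    errA₀ errB₀ : L → Γ → Defect
    errA₂ errA₃ errB₃ errB₄ : Defect
    errA₅ errB₆ : Fin s → Defect

  data Rule : Set where
    scan   : Scan → Rule
    defect : Defect → Rule
    loop   : L → Γ → Rule

  scanTransition : Scan → Transition 6 L Γ
  scanTransition enterA         = trans qI  []                      []                qa₀
  scanTransition (enterB σ)     = trans qI  (O ∷ A ∷ sym σ ∷ [])   []                qb₀
  scanTransition aFirstZero     = trans qa₀ (O ∷ [])                (gO ∷ [])         qa
  scanTransition aZero          = trans qa  (O ∷ [])                (gO ∷ [])         qa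
  scanTransition (aOddEnd σ)    = trans qa  (A ∷ sym σ ∷ [])        (gA ∷ gA ∷ [])    qa₀
  scanTransition (aEvenEnd σ)   = trans qa  (sym σ ∷ [])            (gA ∷ [])         qa₀
  scanTransition bFirstZero     = trans qb₀ (O ∷ [])                (gO ∷ [])         qb
  scanTransition bZero          = trans qb  (O ∷ [])                (gO ∷ [])         qb
  scanTransition (bOddEnd σ)    = trans qb  (O ∷ sym σ ∷ [])        (gA ∷ gA ∷ [])    qb₀
  scanTransition (bEvenEnd σ)   = trans qb  (O ∷ A ∷ sym σ ∷ [])   (gA ∷ [])         qb₀

  defectStep : Defect → Fin 6 × List L × List Γ
  defectStep (errI₁ p)   = qI  , p ∷ []             , []
  defectStep (errI₂ p)   = qI  , O ∷ p ∷ []         , []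
  defectStep (errI₃ p)   = qI  , O ∷ A ∷ p ∷ []     , []
  defectStep (errA₀ p q) = qa₀ , p ∷ []             , q ∷ []
  defectStep (errA₁ p)   = qa  , p ∷ []             , gO ∷ []
  defectStep errA₂       = qa  , O ∷ []             , gA ∷ []
  defectStep errA₃       = qa  , A ∷ []             , gA ∷ gO ∷ []
  defectStep (errA₄ p)   = qa  , A ∷ p ∷ []         , gA ∷ gA ∷ []
  defectStep (errA₅ σ)   = qa  , sym σ ∷ []         , gA ∷ gA ∷ []
  defectStep (errB₀ p q) = qb₀ , p ∷ []             , q ∷ []
  defectStep (errB₁ p)   = qb  , p ∷ []             , gO ∷ []
  defectStep (errB₂ p)   = qb  , p ∷ []             , gA ∷ []
  defectStep errB₃       = qb  , O ∷ O ∷ []         , gA ∷ []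
  defectStep errB₄       = qb  , O ∷ A ∷ []         , gA ∷ gA ∷ []
  defectStep (errB₅ p)   = qb  , O ∷ A ∷ p ∷ []     , gA ∷ []
  defectStep (errB₆ σ)   = qb  , O ∷ sym σ ∷ []     , gA ∷ gO ∷ []

  defectTransition : Defect → Transition 6 L Γ
  defectTransition d = let q , w , w′ = defectStep d in trans q w w′ qF


  transition : Rule → Transition 6 L Γ
  transition (scan g)   = scanTransition g
  transition (defect d) = defectTransition d
  transition (loop p q) = trans qF (p ∷ []) (q ∷ []) qF

  isO isA isSym : L → Bool
  isO O = true
  isO _ = false
  isA A = true
  isA _ = false
  isSym (sym _) = true
  isSym _       = false

  isgO : Γ → Bool
  isgO gO = true
  isgO gA = false

  -- A defect transition must not also be a step of h(x) against α.
  legal : Rule → Bool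
  legal (defect (errI₁ p))   = not (isO p)
  legal (defect (errI₂ p))   = not (isA p)
  legal (defect (errI₃ p))   = not (isSym p)
  legal (defect (errA₀ p q)) = not (isO p ∧ isgO q)
  legal (defect (errA₁ p))   = not (isO p)
  legal (defect (errA₄ p))   = not (isSym p)
  legal (defect (errB₀ p q)) = not (isO p ∧ isgO q)
  legal (defect (errB₁ p))   = not (isO p)
  legal (defect (errB₂ p))   = not (isO p)
  legal (defect (errB₅ p))   = not (isSym p)
  legal _                    = true

  letters : List L
  letters = O ∷ A ∷ map sym (allFin s)

  ∈-letters : ∀ p → p ∈ letters
  ∈-letters O       = here refl
  ∈-letters A       = there (here refl)
  ∈-letters (sym σ) = there (there (∈-map⁺ sym (∈-allFin σ)))

  Γ-letters : List Γ
  Γ-letters = gO ∷ gA ∷ []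

  ∈-Γ-letters : ∀ q → q ∈ Γ-letters
  ∈-Γ-letters gO = here refl
  ∈-Γ-letters gA = there (here refl)

  pairs : List (L × Γ)
  pairs = cartesianProduct letters Γ-letters

  ∈-pairs : ∀ p q → (p , q) ∈ pairs
  ∈-pairs p q = ∈-cartesianProduct⁺ {xs = letters} {ys = Γ-letters} (∈-letters p) (∈-Γ-letters q)

  scanFamilies : List (List Scan)
  scanFamilies =
    (enterA ∷ aFirstZero ∷ aZero ∷ bFirstZero ∷ bZero ∷ []) ∷
    map enterB (allFin s) ∷ map aOddEnd (allFin s) ∷ map aEvenEnd (allFin s) ∷
    map bOddEnd (allFin s) ∷ map bEvenEnd (allFin s) ∷ []

  ∈-scans : ∀ g → g ∈ concat scanFamilies
  ∈-scans enterA       = ∈-concat-lookup scanFamilies (# 0) (here refl)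
  ∈-scans aFirstZero   = ∈-concat-lookup scanFamilies (# 0) (there (here refl))
  ∈-scans aZero        = ∈-concat-lookup scanFamilies (# 0) (there (there (here refl)))
  ∈-scans bFirstZero   = ∈-concat-lookup scanFamilies (# 0) (there (there (there (here refl))))
  ∈-scans bZero        = ∈-concat-lookup scanFamilies (# 0) (there (there (there (there (here refl)))))
  ∈-scans (enterB σ)   = ∈-concat-lookup scanFamilies (# 1) (∈-map⁺ enterB (∈-allFin σ))
  ∈-scans (aOddEnd σ)  = ∈-concat-lookup scanFamilies (# 2) (∈-map⁺ aOddEnd (∈-allFin σ))
  ∈-scans (aEvenEnd σ) = ∈-concat-lookup scanFamilies (# 3) (∈-map⁺ aEvenEnd (∈-allFin σ))
  ∈-scans (bOddEnd σ)  = ∈-concat-lookup scanFamilies (# 4) (∈-map⁺ bOddEnd (∈-allFin σ))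
  ∈-scans (bEvenEnd σ) = ∈-concat-lookup scanFamilies (# 5) (∈-map⁺ bEvenEnd (∈-allFin σ))

  defectFamilies : List (List Defect)
  defectFamilies =
    (errA₂ ∷ errA₃ ∷ errB₃ ∷ errB₄ ∷ []) ∷
    map errI₁ letters ∷ map errI₂ letters ∷ map errI₃ letters ∷ map errA₁ letters ∷
    map errA₄ letters ∷ map errB₁ letters ∷ map errB₂ letters ∷ map errB₅ letters ∷
    map (uncurry errA₀) pairs ∷ map (uncurry errB₀) pairs ∷
    map errA₅ (allFin s) ∷ map errB₆ (allFin s) ∷ []

  ∈-defects : ∀ d → d ∈ concat defectFamilies
  ∈-defects errA₂       = ∈-concat-lookup defectFamilies (# 0) (here refl)
  ∈-defects errA₃       = ∈-concat-lookup defectFamilies (# 0) (there (here refl))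
  ∈-defects errB₃       = ∈-concat-lookup defectFamilies (# 0) (there (there (here refl)))
  ∈-defects errB₄       = ∈-concat-lookup defectFamilies (# 0) (there (there (there (here refl))))
  ∈-defects (errI₁ p)   = ∈-concat-lookup defectFamilies (# 1) (∈-map⁺ errI₁ (∈-letters p))
  ∈-defects (errI₂ p)   = ∈-concat-lookup defectFamilies (# 2) (∈-map⁺ errI₂ (∈-letters p))
  ∈-defects (errI₃ p)   = ∈-concat-lookup defectFamilies (# 3) (∈-map⁺ errI₃ (∈-letters p))
  ∈-defects (errA₁ p)   = ∈-concat-lookup defectFamilies (# 4) (∈-map⁺ errA₁ (∈-letters p))
  ∈-defects (errA₄ p)   = ∈-concat-lookup defectFamilies (# 5) (∈-map⁺ errA₄ (∈-letters p))
  ∈-defects (errB₁ p)   = ∈-concat-lookup defectFamilies (# 6) (∈-map⁺ errB₁ (∈-letters p))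
  ∈-defects (errB₂ p)   = ∈-concat-lookup defectFamilies (# 7) (∈-map⁺ errB₂ (∈-letters p))
  ∈-defects (errB₅ p)   = ∈-concat-lookup defectFamilies (# 8) (∈-map⁺ errB₅ (∈-letters p))
  ∈-defects (errA₀ p q) = ∈-concat-lookup defectFamilies (# 9) (∈-map⁺ (uncurry errA₀) (∈-pairs p q))
  ∈-defects (errB₀ p q) = ∈-concat-lookup defectFamilies (# 10) (∈-map⁺ (uncurry errB₀) (∈-pairs p q))
  ∈-defects (errA₅ σ)   = ∈-concat-lookup defectFamilies (# 11) (∈-map⁺ errA₅ (∈-allFin σ))
  ∈-defects (errB₆ σ)   = ∈-concat-lookup defectFamilies (# 12) (∈-map⁺ errB₆ (∈-allFin σ))

  rules : List Rule
  rules = map scan (concat scanFamilies) ++ map defect (concat defectFamilies) ++ map (uncurry loop) pairs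

  ∈-rules : ∀ r → r ∈ rules
  ∈-rules (scan g)   = ∈-++⁺ˡ (∈-map⁺ scan (∈-scans g))
  ∈-rules (defect d) = ∈-++⁺ʳ (map scan (concat scanFamilies)) (∈-++⁺ˡ (∈-map⁺ defect (∈-defects d)))
  ∈-rules (loop p q) = ∈-++⁺ʳ (map scan (concat scanFamilies))
                         (∈-++⁺ʳ (map defect (concat defectFamilies)) (∈-map⁺ (uncurry loop) (∈-pairs p q)))

  isFinal : Fin 6 → Bool
  isFinal qF = true
  isFinal _  = false

  M : Automaton L Γ
  M = record
    { nstates = 6
    ; Δ       = map transition (filter (T? ∘ legal) rules)
    ; q₀      = qI
    ; F       = isFinal
    }

  rule∈Δ : ∀ r → T (legal r) → transition r ∈ Automaton.Δ M
  rule∈Δ r legal-r = ∈-map⁺ transition (∈-filter⁺ (T? ∘ legal) (∈-rules r) legal-r)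

  Δ⇒rule : ∀ {t} → t ∈ Automaton.Δ M → Σ Rule λ r → T (legal r) × t ≡ transition r
  Δ⇒rule t∈Δ with ∈-map⁻ transition t∈Δ
  ... | r , r∈ , refl = r , proj₂ (∈-filter⁻ (T? ∘ legal) {xs = rules} r∈) , refl

  open Transition

  scan∈Δ : ∀ g → scanTransition g ∈ Automaton.Δ M
  scan∈Δ g = rule∈Δ (scan g) tt

  AcceptsFrom-qF : (u : ω-Word L) (v : ω-Word Γ) → AcceptsFrom M qF u v
  AcceptsFrom-qF = AcceptsFrom-loop M refl (λ p q → rule∈Δ (loop p q) tt)

  AcceptsFrom-defect : ∀ d {u v} → T (legal (defect d)) → inp (defectTransition d) ≼ u → out (defectTransition d) ≼ v →
                       AcceptsFrom M (src (defectTransition d)) u v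
  AcceptsFrom-defect d legal-d pu pv = AcceptsFrom-∷ M (rule∈Δ (defect d) legal-d) pu pv (AcceptsFrom-qF _ _)

  ≢O : {p : L} → T (not (isO p)) → ¬ p ≡ O
  ≢O legal-p refl = legal-p

  ≢A : {p : L} → T (not (isA p)) → ¬ p ≡ A
  ≢A legal-p refl = legal-p

  ≢sym : {p : L} {σ : Fin s} → T (not (isSym p)) → ¬ p ≡ sym σ
  ≢sym legal-p refl = legal-p

  ≢O,gO : {p : L} {q : Γ} → T (not (isO p ∧ isgO q)) → p ≡ O → ¬ q ≡ gO
  ≢O,gO legal-pq refl refl = legal-pq

  hEnd : Bool → Fin s → List L
  hEnd b σ = (if b then A ∷ [] else []) ++ sym σ ∷ []

  αEnd : Bool → List Γ
  αEnd b = if b then gA ∷ gA ∷ [] else gA ∷ []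

  -- αBlock k = replicate (suc k) gO ++ αTail k  holds definitionally.
  αTail : ℕ → List Γ
  αTail k = αEnd (isOdd (suc k))

  αRest : ℕ → ℕ → List Γ
  αRest k j = replicate j gO ++ αTail k

  αTail-head : ∀ k {v} → αTail k ≼ v → v 0 ≡ gA
  αTail-head k = byValue (isOdd (suc k))
    where
    byValue : ∀ b {v} → αEnd b ≼ v → v 0 ≡ gA
    byValue true  p = ≼-head p
    byValue false p = ≼-head p

  αBlock-head : ∀ {k v} → Spells αBlock k v → v 0 ≡ gO
  αBlock-head sp = ≼-head (Spells-head sp)

  module Blocks (x : ω-Word (Fin s)) where

    hb : ℕ → List L
    hb = hBlock x

    -- hb k = replicate (suc k) O ++ hTail k  holds definitionally.
    hTail : ℕ → List L
    hTail k = hEnd (isOdd (suc k)) (x k)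

    hRest : ℕ → ℕ → List L
    hRest k j = replicate j O ++ hTail k

    data Parity (k : ℕ) : Set where
      oddBlock  : hTail k ≡ A ∷ sym (x k) ∷ [] → αTail k ≡ gA ∷ gA ∷ [] →
                  hTail (suc k) ≡ sym (x (suc k)) ∷ [] → Parity k
      evenBlock : hTail k ≡ sym (x k) ∷ [] → αTail k ≡ gA ∷ [] →
                  hTail (suc k) ≡ A ∷ sym (x (suc k)) ∷ [] → Parity k

    parity : ∀ k → Parity k
    parity k = byValue (isOdd (suc k)) refl
      where
      nextEnd : Bool → List L
      nextEnd b = hEnd (if b then false else true) (x (suc k))
      byValue : ∀ b → isOdd (suc k) ≡ b → Parity k
      byValue true  e = oddBlock  (cong (λ b → hEnd b (x k)) e) (cong αEnd e) (cong nextEnd e)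
      byValue false e = evenBlock (cong (λ b → hEnd b (x k)) e) (cong αEnd e) (cong nextEnd e)

    hb-head : ∀ {k u} → Spells hb k u → u 0 ≡ O
    hb-head sp = ≼-head (Spells-head sp)

    hTail-head : ∀ k {u} → hTail k ≼ u → ¬ u 0 ≡ O
    hTail-head k = byValue (isOdd (suc k))
      where
      byValue : ∀ b {u} → hEnd b (x k) ≼ u → ¬ u 0 ≡ O
      byValue true  p u₀≡O = conflict (≼-head p) u₀≡O λ ()
      byValue false p u₀≡O = conflict (≼-head p) u₀≡O λ ()

  -- Soundness: (h(x), α) is rejected

  -- Inv q u v: what a defect-free run on (h(x), α) has left to read on reaching q.  In qa the k-th blocks
  -- of both tapes are being read with j zeros left; in qb the (k+1)-st block of u against the k-th of v.
  module Soundness (x : ω-Word (Fin s)) where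
    open Blocks x

    Inv : Fin 6 → ω-Word L → ω-Word Γ → Set
    Inv qI  u v = Spells hb 0 u × Spells αBlock 0 v
    Inv qa₀ u v = ∃ λ k → Spells hb k u × Spells αBlock k v
    Inv qa  u v = ∃₂ λ k j → Spells⁺ (hRest k j) hb (suc k) u × Spells⁺ (αRest k j) αBlock (suc k) v
    Inv qb₀ u v = ∃ λ k → Spells hb (suc k) u × Spells αBlock k v
    Inv qb  u v = ∃₂ λ k j → Spells⁺ (hRest (suc k) (suc j)) hb (suc (suc k)) u × Spells⁺ (αRest k j) αBlock (suc k) v
    Inv qF  u v = ⊥

    scan-preserves : ∀ g {u v} → let t = scanTransition g in
                     Inv (src t) u v → inp t ≼ u → out t ≼ v →
                     Inv (tgt t) (dropω (length (inp t)) u) (dropω (length (out t)) v)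
    scan-preserves enterA       (su , sv) pu pv = 0 , su , sv
    scan-preserves (enterB σ)   (su , sv) pu pv = 0 , Spells-tail su , sv
    scan-preserves aFirstZero   (k , su , sv) pu pv = k , k , Spells⁺-tail (Spells⇒Spells⁺ su) ,
                                                      Spells⁺-tail (Spells⇒Spells⁺ sv)
    scan-preserves bFirstZero   (k , su , sv) pu pv = k , k , Spells⁺-tail (Spells⇒Spells⁺ su) ,
                                                      Spells⁺-tail (Spells⇒Spells⁺ sv)
    scan-preserves aZero        (k , suc j , ru , rv) pu pv = k , j , Spells⁺-tail ru , Spells⁺-tail rv
    scan-preserves bZero        (k , suc j , ru , rv) pu pv = k , j , Spells⁺-tail ru , Spells⁺-tail rv
    scan-preserves aZero        (k , zero , ru , rv) pu pv = ⊥-elim (conflict (≼-head pv) (αTail-head k (proj₁ rv)) λ ())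
    scan-preserves bZero        (k , zero , ru , rv) pu pv = ⊥-elim (conflict (≼-head pv) (αTail-head k (proj₁ rv)) λ ())
    scan-preserves (aOddEnd σ)  (k , suc j , ru , rv) pu pv = ⊥-elim (conflict (≼-head pv) (≼-head (proj₁ rv)) λ ())
    scan-preserves (aEvenEnd σ) (k , suc j , ru , rv) pu pv = ⊥-elim (conflict (≼-head pv) (≼-head (proj₁ rv)) λ ())
    scan-preserves (bOddEnd σ)  (k , suc j , ru , rv) pu pv = ⊥-elim (conflict (≼-head pv) (≼-head (proj₁ rv)) λ ())
    scan-preserves (bEvenEnd σ) (k , suc j , ru , rv) pu pv = ⊥-elim (conflict (≼-head pv) (≼-head (proj₁ rv)) λ ())
    scan-preserves (aOddEnd σ)  (k , zero , ru , rv) pu pv with parity k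
    ... | oddBlock  e₁ e₂ _ = suc k , proj₂ (Spells⁺-≡ e₁ ru) , proj₂ (Spells⁺-≡ e₂ rv)
    ... | evenBlock _  e₂ _ = ⊥-elim (conflict (≼-second pv) (αBlock-head (proj₂ (Spells⁺-≡ e₂ rv))) λ ())
    scan-preserves (aEvenEnd σ) (k , zero , ru , rv) pu pv with parity k
    ... | oddBlock  e₁ _  _ = ⊥-elim (conflict (≼-head pu) (≼-head (proj₁ (Spells⁺-≡ e₁ ru))) λ ())
    ... | evenBlock e₁ e₂ _ = suc k , proj₂ (Spells⁺-≡ e₁ ru) , proj₂ (Spells⁺-≡ e₂ rv)
    scan-preserves (bOddEnd σ)  (k , zero , ru , rv) pu pv with parity k
    ... | oddBlock  _ e₂ e₃ = suc k , proj₂ (Spells⁺-≡ e₃ (Spells⁺-tail ru)) , proj₂ (Spells⁺-≡ e₂ rv)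
    ... | evenBlock _ _  e₃ = ⊥-elim (conflict (≼-second pu) (≼-head (proj₁ (Spells⁺-≡ e₃ (Spells⁺-tail ru)))) λ ())
    scan-preserves (bEvenEnd σ) (k , zero , ru , rv) pu pv with parity k
    ... | oddBlock  _ _  e₃ = ⊥-elim (conflict (≼-second pu) (≼-head (proj₁ (Spells⁺-≡ e₃ (Spells⁺-tail ru)))) λ ())
    ... | evenBlock _ e₂ e₃ = suc k , proj₂ (Spells⁺-≡ e₃ (Spells⁺-tail ru)) , proj₂ (Spells⁺-≡ e₂ rv)

    defect-impossible : ∀ d {u v} → let t = defectTransition d in
                        T (legal (defect d)) → Inv (src t) u v → inp t ≼ u → out t ≼ v → ⊥
    defect-impossible (errI₁ p)   ok (su , sv) pu pv = ≢O ok (agree (≼-head pu) (hb-head su))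
    defect-impossible (errI₂ p)   ok (su , sv) pu pv = ≢A ok (agree (≼-second pu) (≼-second (Spells-head su)))
    defect-impossible (errI₃ p)   ok (su , sv) pu pv = ≢sym ok (agree (≼-third pu) (≼-third (Spells-head su)))
    defect-impossible (errA₀ p q) ok (k , su , sv) pu pv =
      ≢O,gO ok (agree (≼-head pu) (hb-head su)) (agree (≼-head pv) (αBlock-head sv))
    defect-impossible (errB₀ p q) ok (k , su , sv) pu pv =
      ≢O,gO ok (agree (≼-head pu) (hb-head su)) (agree (≼-head pv) (αBlock-head sv))
    defect-impossible (errA₁ p)   ok (k , suc j , ru , rv) pu pv = ≢O ok (agree (≼-head pu) (≼-head (proj₁ ru)))
    defect-impossible (errB₁ p)   ok (k , suc j , ru , rv) pu pv = ≢O ok (agree (≼-head pu) (≼-head (proj₁ ru)))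
    defect-impossible (errB₂ p)   ok (k , zero , ru , rv) pu pv = ≢O ok (agree (≼-head pu) (≼-head (proj₁ ru)))
    defect-impossible (errA₁ p)   ok (k , zero , ru , rv) pu pv = conflict (≼-head pv) (αTail-head k (proj₁ rv)) λ ()
    defect-impossible (errB₁ p)   ok (k , zero , ru , rv) pu pv = conflict (≼-head pv) (αTail-head k (proj₁ rv)) λ ()
    defect-impossible errA₂       ok (k , zero , ru , rv) pu pv = hTail-head k (proj₁ ru) (≼-head pu)
    defect-impossible errB₃       ok (k , zero , ru , rv) pu pv = hTail-head (suc k) (≼-tail (proj₁ ru)) (≼-second pu)
    defect-impossible errA₂       ok (k , suc j , ru , rv) pu pv = conflict (≼-head pv) (≼-head (proj₁ rv)) λ ()
    defect-impossible errA₃       ok (k , suc j , ru , rv) pu pv = conflict (≼-head pv) (≼-head (proj₁ rv)) λ ()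
    defect-impossible (errA₄ p)   ok (k , suc j , ru , rv) pu pv = conflict (≼-head pv) (≼-head (proj₁ rv)) λ ()
    defect-impossible (errA₅ σ)   ok (k , suc j , ru , rv) pu pv = conflict (≼-head pv) (≼-head (proj₁ rv)) λ ()
    defect-impossible (errB₂ p)   ok (k , suc j , ru , rv) pu pv = conflict (≼-head pv) (≼-head (proj₁ rv)) λ ()
    defect-impossible errB₃       ok (k , suc j , ru , rv) pu pv = conflict (≼-head pv) (≼-head (proj₁ rv)) λ ()
    defect-impossible errB₄       ok (k , suc j , ru , rv) pu pv = conflict (≼-head pv) (≼-head (proj₁ rv)) λ ()
    defect-impossible (errB₅ p)   ok (k , suc j , ru , rv) pu pv = conflict (≼-head pv) (≼-head (proj₁ rv)) λ ()
    defect-impossible (errB₆ σ)   ok (k , suc j , ru , rv) pu pv = conflict (≼-head pv) (≼-head (proj₁ rv)) λ ()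
    defect-impossible errA₃       ok (k , zero , ru , rv) pu pv with parity k
    ... | oddBlock  _  e₂ _ = conflict (≼-second pv) (≼-second (proj₁ (Spells⁺-≡ e₂ rv))) λ ()
    ... | evenBlock e₁ _  _ = conflict (≼-head pu) (≼-head (proj₁ (Spells⁺-≡ e₁ ru))) λ ()
    defect-impossible (errA₄ p)   ok (k , zero , ru , rv) pu pv with parity k
    ... | oddBlock  e₁ _  _ = ≢sym ok (agree (≼-second pu) (≼-second (proj₁ (Spells⁺-≡ e₁ ru))))
    ... | evenBlock _  e₂ _ = conflict (≼-second pv) (αBlock-head (proj₂ (Spells⁺-≡ e₂ rv))) λ ()
    defect-impossible (errA₅ σ)   ok (k , zero , ru , rv) pu pv with parity k
    ... | oddBlock  e₁ _  _ = conflict (≼-head pu) (≼-head (proj₁ (Spells⁺-≡ e₁ ru))) λ ()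
    ... | evenBlock _  e₂ _ = conflict (≼-second pv) (αBlock-head (proj₂ (Spells⁺-≡ e₂ rv))) λ ()
    defect-impossible errB₄       ok (k , zero , ru , rv) pu pv with parity k
    ... | oddBlock  _ _  e₃ = conflict (≼-second pu) (≼-head (proj₁ (Spells⁺-≡ e₃ (Spells⁺-tail ru)))) λ ()
    ... | evenBlock _ e₂ _  = conflict (≼-second pv) (αBlock-head (proj₂ (Spells⁺-≡ e₂ rv))) λ ()
    defect-impossible (errB₅ p)   ok (k , zero , ru , rv) pu pv with parity k
    ... | oddBlock  _ _ e₃ = conflict (≼-second pu) (≼-head (proj₁ (Spells⁺-≡ e₃ (Spells⁺-tail ru)))) λ ()
    ... | evenBlock _ _ e₃ = ≢sym ok (agree (≼-third pu) (≼-second (proj₁ (Spells⁺-≡ e₃ (Spells⁺-tail ru)))))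
    defect-impossible (errB₆ σ)   ok (k , zero , ru , rv) pu pv with parity k
    ... | oddBlock  _ e₂ _ = conflict (≼-second pv) (≼-second (proj₁ (Spells⁺-≡ e₂ rv))) λ ()
    ... | evenBlock _ _ e₃ = conflict (≼-second pu) (≼-head (proj₁ (Spells⁺-≡ e₃ (Spells⁺-tail ru)))) λ ()

    preserved : ∀ {t u v} → t ∈ Automaton.Δ M → Inv (src t) u v → inp t ≼ u → out t ≼ v →
                Inv (tgt t) (dropω (length (inp t)) u) (dropω (length (out t)) v)
    preserved t∈Δ with Δ⇒rule t∈Δ
    ... | scan g     , _  , refl = scan-preserves g
    ... | defect d   , ok , refl = defect-impossible d ok
    ... | loop p q   , _  , refl = λ ()

    nonfinal : ∀ {q u v} → isFinal q ≡ true → ¬ Inv q u v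
    nonfinal {qF} _ ()

  h×α-rejected : ∀ {u v} → (∃ λ x → IsH x u) → Isα v → ¬ Accepts M u v
  h×α-rejected {u} {v} (x , u≡hx) v≡α acc =
    invariant⇒¬AcceptsFrom M Inv preserved nonfinal
      (IsConcat⇒Spells {u = u} u≡hx , IsConcat⇒Spells {u = v} v≡α) (Accepts⇒AcceptsFrom M acc)
    where open Soundness x

  -- Completeness: rejected pairs are (h(x), α)

  -- Phase a also shows that an even block of α is followed by a zero; phase b needs this to reject the end O σ against A.
  αPeek : Bool → List Γ
  αPeek b = if b then [] else gO ∷ []

  hBlock-length : (x : ω-Word (Fin s)) (k : ℕ) → length (hBlock x k) ≡ length (αBlock k)
  hBlock-length x k = byValue (suc k) (isOdd (suc k))
    where
    byValue : ∀ n b → length (replicate n O ++ hEnd b (x k)) ≡ length (replicate n gO ++ αEnd b)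
    byValue zero    true  = refl
    byValue zero    false = refl
    byValue (suc n) b     = cong suc (byValue n b)

  symbolOffset : ℕ → ℕ
  symbolOffset k = suc k + (if isOdd (suc k) then 1 else 0)

  hBlock-symbol : ∀ k σ {w} → hBlock (λ _ → σ) k ≼ w → w (symbolOffset k) ≡ sym σ
  hBlock-symbol k σ p = byValue (isOdd (suc k)) (≼-replicate-++⁻ʳ (suc k) p)
    where
    byValue : ∀ b {w} → hEnd b σ ≼ w → w (if b then 1 else 0) ≡ sym σ
    byValue true  p = ≼-second p
    byValue false p = ≼-head p

  zeros-scan : (q : Fin 6) → trans q (O ∷ []) (gO ∷ []) q ∈ Automaton.Δ M →
               ∀ j {u v} → replicate j O ≼ u → replicate j gO ≼ v →
               AcceptsFrom M q (dropω j u) (dropω j v) → AcceptsFrom M q u v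
  zeros-scan q loop∈Δ zero    pu pv acc = acc
  zeros-scan q loop∈Δ (suc j) pu pv acc =
    AcceptsFrom-∷ M loop∈Δ (≼¹ (≼-head pu)) (≼¹ (≼-head pv)) (zeros-scan q loop∈Δ j (≼-tail pu) (≼-tail pv) acc)

  aEnd-scan : ∀ b σ {u v} → hEnd b σ ≼ u → αEnd b ≼ v →
              AcceptsFrom M qa₀ (dropω (length (hEnd b σ)) u) (dropω (length (αEnd b)) v) → AcceptsFrom M qa u v
  aEnd-scan true  σ = AcceptsFrom-∷ M (scan∈Δ (aOddEnd σ))
  aEnd-scan false σ = AcceptsFrom-∷ M (scan∈Δ (aEvenEnd σ))

  bEnd-scan : ∀ b σ {u v} → (O ∷ hEnd (if b then false else true) σ) ≼ u → αEnd b ≼ v →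
              AcceptsFrom M qb₀ (dropω (length (O ∷ hEnd (if b then false else true) σ)) u) (dropω (length (αEnd b)) v) →
              AcceptsFrom M qb u v
  bEnd-scan true  σ = AcceptsFrom-∷ M (scan∈Δ (bOddEnd σ))
  bEnd-scan false σ = AcceptsFrom-∷ M (scan∈Δ (bEvenEnd σ))

  aBlock-scan : ∀ k σ {u v} → hBlock (λ _ → σ) k ≼ u → αBlock k ≼ v →
                AcceptsFrom M qa₀ (dropω (length (hBlock (λ _ → σ) k)) u) (dropω (length (αBlock k)) v) →
                AcceptsFrom M qa₀ u v
  aBlock-scan k σ {u} {v} pu pv acc =
    AcceptsFrom-∷ M (scan∈Δ aFirstZero) (≼¹ (≼-head pu)) (≼¹ (≼-head pv))
      (zeros-scan qa (scan∈Δ aZero) k (≼-++⁻ˡ (replicate k O) (≼-tail pu)) (≼-++⁻ˡ (replicate k gO) (≼-tail pv))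
        (aEnd-scan b σ (≼-replicate-++⁻ʳ k (≼-tail pu)) (≼-replicate-++⁻ʳ k (≼-tail pv))
          (AcceptsFrom-resp M (dropω-replicate-++ k (hEnd b σ) (dropω 1 u)) (dropω-replicate-++ k (αEnd b) (dropω 1 v)) acc)))
    where b = isOdd (suc k)

  -- The extra zero of the longer block of u is read last, together with its end.
  bBlock-scan : ∀ k σ {u v} → hBlock (λ _ → σ) (suc k) ≼ u → αBlock k ≼ v →
                AcceptsFrom M qb₀ (dropω (length (hBlock (λ _ → σ) (suc k))) u) (dropω (length (αBlock k)) v) →
                AcceptsFrom M qb₀ u v
  bBlock-scan k σ {u} {v} pu pv acc =
    AcceptsFrom-∷ M (scan∈Δ bFirstZero) (≼¹ (≼-head pu)) (≼¹ (≼-head pv))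
      (zeros-scan qb (scan∈Δ bZero) k (≼-++⁻ˡ (replicate k O) pu′) (≼-++⁻ˡ (replicate k gO) (≼-tail pv))
        (bEnd-scan b σ (≼-replicate-++⁻ʳ k pu′) (≼-replicate-++⁻ʳ k (≼-tail pv))
          (AcceptsFrom-resp M u≐ (dropω-replicate-++ k (αEnd b) (dropω 1 v)) acc)))
    where
    b = isOdd (suc k)
    end = hEnd (if b then false else true) σ
    reassoc : replicate k O ++ O ∷ end ≡ O ∷ replicate k O ++ end
    reassoc = replicate-++-∷ k O end
    pu′ : (replicate k O ++ O ∷ end) ≼ dropω 1 u
    pu′ = subst (_≼ dropω 1 u) (≡-sym reassoc) (≼-tail pu)
    u≐ : dropω (length (hBlock (λ _ → σ) (suc k))) u ≐ dropω (length (O ∷ end)) (dropω k (dropω 1 u))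
    u≐ i = ≡-trans (dropω-cong (dropω 1 u) (cong length (≡-sym reassoc)) i) (dropω-replicate-++ k (O ∷ end) (dropω 1 u) i)

  αEnd-forced : ∀ b σ {u v} → hEnd b σ ≼ u → ¬ AcceptsFrom M qa u v → (αEnd b ++ αPeek b) ≼ v
  αEnd-forced true σ {v = v} pu rej with v 0 in e₀ | v 1 in e₁
  ... | gO | _  = ⊥-elim (rej (AcceptsFrom-defect (errA₁ A) tt (≼¹ (≼-head pu)) (≼¹ e₀)))
  ... | gA | gO = ⊥-elim (rej (AcceptsFrom-defect errA₃ tt (≼¹ (≼-head pu)) (≼² e₀ e₁)))
  ... | gA | gA = ≼² e₀ e₁
  αEnd-forced false σ {v = v} pu rej with v 0 in e₀ | v 1 in e₁
  ... | gO | _  = ⊥-elim (rej (AcceptsFrom-defect (errA₁ (sym σ)) tt (≼¹ (≼-head pu)) (≼¹ e₀)))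
  ... | gA | gA = ⊥-elim (rej (AcceptsFrom-defect (errA₅ σ) tt (≼¹ (≼-head pu)) (≼² e₀ e₁)))
  ... | gA | gO = ≼² e₀ e₁

  αZeros-forced : ∀ j {u v} → replicate j O ≼ u → ¬ AcceptsFrom M qa u v →
                  replicate j gO ≼ v × ¬ AcceptsFrom M qa (dropω j u) (dropω j v)
  αZeros-forced zero    pu rej = ≼-[] , rej
  αZeros-forced (suc j) {v = v} pu rej with v 0 in e₀
  ... | gA = ⊥-elim (rej (AcceptsFrom-defect errA₂ tt (≼¹ (≼-head pu)) (≼¹ e₀)))
  ... | gO with αZeros-forced j (≼-tail pu) (rej ∘ AcceptsFrom-∷ M (scan∈Δ aZero) (≼¹ (≼-head pu)) (≼¹ e₀))
  ...   | pv , rej′ = ≼-∷ e₀ pv , rej′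

  αBlock-forced : ∀ k σ {u v} → hBlock (λ _ → σ) k ≼ u → ¬ AcceptsFrom M qa₀ u v →
                  (αBlock k ++ αPeek (isOdd (suc k))) ≼ v
  αBlock-forced k σ {v = v} pu rej with v 0 in e₀
  ... | gA = ⊥-elim (rej (AcceptsFrom-defect (errA₀ O gA) tt (≼¹ (≼-head pu)) (≼¹ e₀)))
  ... | gO with αZeros-forced k (≼-++⁻ˡ (replicate k O) (≼-tail pu))
                 (rej ∘ AcceptsFrom-∷ M (scan∈Δ aFirstZero) (≼¹ (≼-head pu)) (≼¹ e₀))
  ...   | pv , rej′ = ≼-∷ e₀ (subst (_≼ dropω 1 v) (≡-sym (++-assoc (replicate k gO) (αEnd b) (αPeek b)))
                        (≼-replicate-++⁺ k pv (αEnd-forced b σ (≼-replicate-++⁻ʳ k (≼-tail pu)) rej′)))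
    where b = isOdd (suc k)

  hEnd-forced : ∀ b {u v} → (αEnd b ++ αPeek b) ≼ v → ¬ AcceptsFrom M qb u v →
                ∃ λ σ → (O ∷ hEnd (if b then false else true) σ) ≼ u
  hEnd-forced true {u} pv rej with u 0 in e₀ | u 1 in e₁
  ... | A     | _     = ⊥-elim (rej (AcceptsFrom-defect (errB₂ A) tt (≼¹ e₀) (≼¹ (≼-head pv))))
  ... | sym τ | _     = ⊥-elim (rej (AcceptsFrom-defect (errB₂ (sym τ)) tt (≼¹ e₀) (≼¹ (≼-head pv))))
  ... | O     | O     = ⊥-elim (rej (AcceptsFrom-defect errB₃ tt (≼² e₀ e₁) (≼¹ (≼-head pv))))
  ... | O     | A     = ⊥-elim (rej (AcceptsFrom-defect errB₄ tt (≼² e₀ e₁) pv))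
  ... | O     | sym σ = σ , ≼² e₀ e₁
  hEnd-forced false {u} pv rej with u 0 in e₀ | u 1 in e₁ | u 2 in e₂
  ... | A     | _     | _     = ⊥-elim (rej (AcceptsFrom-defect (errB₂ A) tt (≼¹ e₀) (≼¹ (≼-head pv))))
  ... | sym τ | _     | _     = ⊥-elim (rej (AcceptsFrom-defect (errB₂ (sym τ)) tt (≼¹ e₀) (≼¹ (≼-head pv))))
  ... | O     | O     | _     = ⊥-elim (rej (AcceptsFrom-defect errB₃ tt (≼² e₀ e₁) (≼¹ (≼-head pv))))
  ... | O     | sym τ | _     = ⊥-elim (rej (AcceptsFrom-defect (errB₆ τ) tt (≼² e₀ e₁) pv))
  ... | O     | A     | O     = ⊥-elim (rej (AcceptsFrom-defect (errB₅ O) tt (≼³ e₀ e₁ e₂) (≼¹ (≼-head pv))))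
  ... | O     | A     | A     = ⊥-elim (rej (AcceptsFrom-defect (errB₅ A) tt (≼³ e₀ e₁ e₂) (≼¹ (≼-head pv))))
  ... | O     | A     | sym σ = σ , ≼³ e₀ e₁ e₂

  hZeros-forced : ∀ j {u v} → replicate j gO ≼ v → ¬ AcceptsFrom M qb u v →
                  replicate j O ≼ u × ¬ AcceptsFrom M qb (dropω j u) (dropω j v)
  hZeros-forced zero    pv rej = ≼-[] , rej
  hZeros-forced (suc j) {u} pv rej with u 0 in e₀
  ... | A     = ⊥-elim (rej (AcceptsFrom-defect (errB₁ A) tt (≼¹ e₀) (≼¹ (≼-head pv))))
  ... | sym τ = ⊥-elim (rej (AcceptsFrom-defect (errB₁ (sym τ)) tt (≼¹ e₀) (≼¹ (≼-head pv))))
  ... | O with hZeros-forced j (≼-tail pv) (rej ∘ AcceptsFrom-∷ M (scan∈Δ bZero) (≼¹ e₀) (≼¹ (≼-head pv)))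
  ...   | pu , rej′ = ≼-∷ e₀ pu , rej′

  hBlock-forced : ∀ k {u v} → (αBlock k ++ αPeek (isOdd (suc k))) ≼ v → ¬ AcceptsFrom M qb₀ u v →
                  ∃ λ σ → hBlock (λ _ → σ) (suc k) ≼ u
  hBlock-forced k {u} {v} pv rej with u 0 in e₀
  ... | A     = ⊥-elim (rej (AcceptsFrom-defect (errB₀ A gO) tt (≼¹ e₀) (≼¹ (≼-head pv))))
  ... | sym τ = ⊥-elim (rej (AcceptsFrom-defect (errB₀ (sym τ) gO) tt (≼¹ e₀) (≼¹ (≼-head pv))))
  ... | O =
    let pu , rej′ = hZeros-forced k (≼-++⁻ˡ (replicate k gO) pv′)
                      (rej ∘ AcceptsFrom-∷ M (scan∈Δ bFirstZero) (≼¹ e₀) (≼¹ (≼-head pv)))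
        σ , pend  = hEnd-forced b (≼-replicate-++⁻ʳ k pv′) rej′
    in  σ , ≼-∷ e₀ (subst (_≼ dropω 1 u) (replicate-++-∷ k O _) (≼-replicate-++⁺ k pu pend))
    where
    b = isOdd (suc k)
    pv′ : (replicate k gO ++ αEnd b ++ αPeek b) ≼ dropω 1 v
    pv′ = subst (_≼ dropω 1 v) (++-assoc (replicate k gO) (αEnd b) (αPeek b)) (≼-tail pv)

  module Completeness (u : ω-Word L) (v : ω-Word Γ) (rejected : ¬ AcceptsFrom M qI u v) where

    first-block : Σ (Fin s) λ σ → hBlock (λ _ → σ) 0 ≼ u
    first-block with u 0 in e₀ | u 1 in e₁ | u 2 in e₂
    ... | O     | A     | sym σ = σ , ≼³ e₀ e₁ e₂
    ... | A     | _     | _     = ⊥-elim (rejected (AcceptsFrom-defect (errI₁ A) tt (≼¹ e₀) ≼-[]))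
    ... | sym τ | _     | _     = ⊥-elim (rejected (AcceptsFrom-defect (errI₁ (sym τ)) tt (≼¹ e₀) ≼-[]))
    ... | O     | O     | _     = ⊥-elim (rejected (AcceptsFrom-defect (errI₂ O) tt (≼² e₀ e₁) ≼-[]))
    ... | O     | sym τ | _     = ⊥-elim (rejected (AcceptsFrom-defect (errI₂ (sym τ)) tt (≼² e₀ e₁) ≼-[]))
    ... | O     | A     | O     = ⊥-elim (rejected (AcceptsFrom-defect (errI₃ O) tt (≼³ e₀ e₁ e₂) ≼-[]))
    ... | O     | A     | A     = ⊥-elim (rejected (AcceptsFrom-defect (errI₃ A) tt (≼³ e₀ e₁ e₂) ≼-[]))

    -- Σ may be empty, so the default value comes from the first block.
    symbolAt : L → Fin s
    symbolAt (sym σ) = σ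
    symbolAt _       = proj₁ first-block

    -- The blocks of h(x) and of α have equal lengths, so the position of x k can be computed from α alone.
    x : ω-Word (Fin s)
    x k = symbolAt (u (length (catUpTo αBlock k) + symbolOffset k))

    open Blocks x

    hb-at : ∀ k σ → hBlock (λ _ → σ) k ≼ dropω (length (catUpTo hb k)) u → hb k ≼ dropω (length (catUpTo hb k)) u
    hb-at k σ p = subst (λ τ → hBlock (λ _ → τ) k ≼ _) (≡-sym x≡σ) p
      where
      open ≡-Reasoning
      same-length : length (catUpTo hb k) ≡ length (catUpTo αBlock k)
      same-length = length-catUpTo-cong hb αBlock (hBlock-length x) k
      x≡σ : x k ≡ σ
      x≡σ = cong symbolAt (begin
        u (length (catUpTo αBlock k) + symbolOffset k) ≡⟨ cong (λ n → u (n + symbolOffset k)) same-length ⟨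
        u (length (catUpTo hb k) + symbolOffset k)     ≡⟨ hBlock-symbol k σ p ⟩
        sym σ                                          ∎)

    phaseA-rejects : ∀ K → catUpTo hb K ≼ u → catUpTo αBlock K ≼ v →
                     ¬ AcceptsFrom M qa₀ (dropω (length (catUpTo hb K)) u) (dropω (length (catUpTo αBlock K)) v)
    phaseA-rejects K pu pv acc =
      rejected (AcceptsFrom-∷ M (scan∈Δ enterA) ≼-[] ≼-[]
        (AcceptsFrom-blocks M hb αBlock (λ k → aBlock-scan k (x k)) K pu pv acc))

    phaseB-rejects : ∀ K → catUpTo hb (suc K) ≼ u → catUpTo αBlock K ≼ v →
                     ¬ AcceptsFrom M qb₀ (dropω (length (catUpTo hb (suc K))) u) (dropω (length (catUpTo αBlock K)) v)
    phaseB-rejects K pu pv acc =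
      rejected (AcceptsFrom-∷ M (scan∈Δ (enterB (x 0))) (≼-++⁻ˡ (hb 0) pu′) ≼-[]
        (AcceptsFrom-blocks M (λ k → hb (suc k)) αBlock (λ k → bBlock-scan k (x (suc k))) K (≼-++⁻ʳ (hb 0) pu′) pv
          (AcceptsFrom-resp M u≐ (λ _ → refl) acc)))
      where
      split : catUpTo hb (suc K) ≡ hb 0 ++ catUpTo (λ k → hb (suc k)) K
      split = catUpTo-suc hb K
      pu′ : (hb 0 ++ catUpTo (λ k → hb (suc k)) K) ≼ u
      pu′ = subst (_≼ u) split pu
      u≐ : dropω (length (catUpTo hb (suc K))) u ≐ dropω (length (catUpTo (λ k → hb (suc k)) K)) (dropω 3 u)
      u≐ i = ≡-trans (dropω-cong u (cong length split) i) (dropω-++ (hb 0) (catUpTo (λ k → hb (suc k)) K) u i)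

    Parsed : ℕ → Set
    Parsed K = catUpTo hb (suc K) ≼ u × catUpTo αBlock K ≼ v

    parsed : ∀ K → Parsed K
    parsed zero    = hb-at 0 (proj₁ first-block) (proj₂ first-block) , ≼-[]
    parsed (suc K) with parsed K
    ... | pu , pv = ≼-++⁺ (catUpTo hb (suc K)) pu (hb-at (suc K) (proj₁ next) (proj₂ next)) ,
                    ≼-++⁺ (catUpTo αBlock K) pv (≼-++⁻ˡ (αBlock K) pα)
      where
      pα = αBlock-forced K (x K) (≼-++⁻ʳ (catUpTo hb K) pu) (phaseA-rejects K (≼-++⁻ˡ (catUpTo hb K) pu) pv)
      next = hBlock-forced K pα (phaseB-rejects K pu pv)

  rejected⇒h×α : ∀ {u v} → ¬ Accepts M u v → (∃ λ x → IsH x u) × Isα v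
  rejected⇒h×α {u} {v} rej =
      (x , IsConcat-intro (λ k → s≤s z≤n) (λ K → ≼-++⁻ˡ (catUpTo hb K) (proj₁ (parsed K))))
    , IsConcat-intro (λ k → s≤s z≤n) (λ K → proj₂ (parsed K))
    where
    open Completeness u v (rej ∘ AcceptsFrom⇒Accepts M)
    open Blocks x

lemma3p7 : ExcludedMiddle 0ℓ → (s : ℕ) → InfinitaryRational (R₂ s)
lemma3p7 lem s = M s , λ u v → accepted u v , λ acc (h , α) → h×α-rejected s {u} {v} h α acc
  where
  accepted : ∀ u v → R₂ s u v → Accepts (M s) u v
  accepted u v not-h×α = decidable-stable lem (not-h×α ∘ rejected⇒h×α s {u} {v})
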